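{- For every integer $l\geq 6$, the graph $G_l$ satisfies $|E(G_l)|<2^{2l}$ and has diameter at most $3$.
   Context: For an integer $l\ge 1$ and $k\ge 0$, $j\in\{0,\ldots,2^l-1\}$, let $b_k(j)=\lfloor j/2^k\rfloor \bmod 2$ be the $k$-th rightmost bit of $j$, and let $\oplus$ denote bitwise xor. Define permutations $\pi_i$ of $\{0,\ldots,2^l-1\}$ by $\pi_0(j)=j$ and, for $i\ge 1$, $\pi_i(j)=(j-2^ib_i(j)-2^{i-1}b_{i-1}(j))+2^ib_{i-1}(j)+2^{i-1}b_i(j)$ (swap bits $i$ and $i-1$). The port-labeled graph $G_l$ has nodes $v_i(j)$ for levels $i\in\{0,\ldots,l+1\}$ and columns $j\in\{0,\ldots,2^l-1\}$, and the following edges, where $\lambda(u,v)$ denotes the port number at $u$ of edge $\{u,v\}$: (1) for each $j$, an edge $\{v_0(j),v_0(j\oplus 1)\}$ with $\lambda(v_0(j),v_0(j\oplus1))=1+((j+1)\bmod 2)$; (2) for each $j$ and each $p\in\{1,\ldots,2^l-1\}$, an edge $\{v_{l+1}(j),v_{l+1}((j+p)\bmod 2^l)\}$ with $\lambda(v_{l+1}(j),v_{l+1}((j+p)\bmod 2^l))=p$; (3) for each $j$ and $i\in\{0,\ldots,l\}$, an edge $\{v_{l+1}(j),v_i(j)\}$ with $\lambda(v_{l+1}(j),v_i(j))=2^l+i$, and $\lambda(v_i(j),v_{l+1}(j))=1$ if $i>0$, $\lambda(v_0(j),v_{l+1}(j))=1+(j\bmod 2)$; (4) for each $j$ and $i\in\{0,\ldots,l-1\}$,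 an edge $\{v_i(j),v_{i+1}(\pi_i(j))\}$ with $\lambda(v_i(j),v_{i+1}(\pi_i(j)))=3$ and $\lambda(v_{i+1}(\pi_i(j)),v_i(j))=2$. The diameter is the maximum shortest-path distance between two nodes. -}

module Defs where

open import Data.Nat using (ℕ; zero; suc; _+_; _*_; _∸_; _^_; _≤_; _<_; _/_; _%_)
open import Data.Nat using (_<?_)
open import Data.Nat.Properties using (_≟_; m^n≢0)
open import Data.Product using (_×_; _,_; ∃-syntax)
open import Data.Product.Properties using (≡-dec)
open import Data.List using (List; []; _∷_; map; concatMap; upTo; length; deduplicate; _++_)
open import Data.List.Membership.Propositional using (_∈_)
open import Data.Sum using (_⊎_)
open import Relation.Nullary using (yes; no)

bit : ℕ → ℕ → ℕ
bit k j = _/_ j (2 ^ k) {{m^n≢0 2 k}} % 2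

-- j ⊕ 1 : flip bit 0 of j
xor1 : ℕ → ℕ
xor1 j = (j ∸ bit 0 j) + (1 ∸ bit 0 j)

-- π_0 = id ; π_i (i ≥ 1) swaps bits i and i-1
π : ℕ → ℕ → ℕ
π zero    j = j
π (suc i) j =
  ((j ∸ (2 ^ suc i) * bit (suc i) j) ∸ (2 ^ i) * bit i j)
  + (2 ^ suc i) * bit i j + (2 ^ i) * bit (suc i) j

-- nodes v_i(j) are represented as pairs (i , j) : level , column
Node : Set
Node = ℕ × ℕ

IsNode : ℕ → Node → Set
IsNode l (i , j) = (i ≤ l + 1) × (j < 2 ^ l)

-- generating edge lists (ordered pairs, as listed in rules (1)-(4))
edges1 : ℕ → List (Node × Node)
edges1 l = map (λ j → ((0 , j) , (0 , xor1 j))) (upTo (2 ^ l))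

edges2 : ℕ → List (Node × Node)
edges2 l = concatMap (λ j → map (λ p → ((l + 1 , j) , (l + 1 , _%_ (j + p) (2 ^ l) {{m^n≢0 2 l}})))
                                (map suc (upTo (2 ^ l ∸ 1))))
                     (upTo (2 ^ l))

edges3 : ℕ → List (Node × Node)
edges3 l = concatMap (λ j → map (λ i → ((l + 1 , j) , (i , j))) (upTo (l + 1))) (upTo (2 ^ l))

edges4 : ℕ → List (Node × Node)
edges4 l = concatMap (λ j → map (λ i → ((i , j) , (suc i , π i j))) (upTo l)) (upTo (2 ^ l))

edgeList : ℕ → List (Node × Node)
edgeList l = edges1 l ++ edges2 l ++ edges3 l ++ edges4 l

-- canonical (lexicographically ordered) representative of the unordered pair {u , v}
normalize : Node × Node → Node × Node
normalize ((i , j) , (i' , j')) with i' <? i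
... | yes _ = ((i' , j') , (i , j))
... | no _ with i ≟ i'
...   | no _ = ((i , j) , (i' , j'))
...   | yes _ with j' <? j
...     | yes _ = ((i' , j') , (i , j))
...     | no _ = ((i , j) , (i' , j'))

EdgeSet : ℕ → List (Node × Node)
EdgeSet l = deduplicate (≡-dec (≡-dec _≟_ _≟_) (≡-dec _≟_ _≟_)) (map normalize (edgeList l))

numEdges : ℕ → ℕ
numEdges l = length (EdgeSet l)

Adj : ℕ → Node → Node → Set
Adj l u v = ((u , v) ∈ edgeList l) ⊎ ((v , u) ∈ edgeList l)

data Walk (l : ℕ) : ℕ → Node → Node → Set where
  here : ∀ {u} → Walk l 0 u u
  step : ∀ {k u v w} → Adj l u v → Walk l k v w → Walk l (suc k) u w

DistLeq : ℕ → Node → Node → ℕ → Set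
DistLeq l u v d = ∃[ k ] ((k ≤ d) × Walk l k u v)

DiamLeq : ℕ → ℕ → Set
DiamLeq l d = ∀ u v → IsNode l u → IsNode l v → DistLeq l u v d

-- Every node v_i(j) is v_{l+1}(j) or adjacent to it (rule 3), and the top level is a clique
-- (rule 2), so any two nodes are joined by a walk up to level l+1, across and down again, of length at most 3.
-- For the edge count, write n = 2^l: rules 1, 3 and 4 list n + n(l+1) + nl edges, and the
-- clique contributes only its n(n-1)/2 unordered pairs.  Since 4l + 4 ≤ n once l ≥ 6,
-- twice the total is at most n(4l+4) + n² - n < 2n².
module Submission where

open import Defs
open import Data.Nat using (ℕ; zero; suc; _+_; _*_; _∸_; _≤_; _<_; _^_; z≤n; s≤s; NonZero; >-nonZero; z<s; _<?_; _/_; _%_)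
open import Data.Nat.Properties
open import Data.Nat.DivMod using (m%n<n; m<n⇒m%n≡m; m≡m%n+[m/n]*n)
open import Data.Nat.Divisibility using (divides; ∣⇒≤)
open import Data.Nat.Tactic.RingSolver using (solve-∀)
open import Data.Product using (_×_; _,_; ∃-syntax)
open import Data.Product.Properties using (≡-dec)
open import Data.Sum using (_⊎_; inj₁; inj₂)
open import Data.Empty using (⊥-elim)
open import Data.List using (List; []; _∷_; map; concatMap; upTo; length; _++_)
open import Data.Nat.ListAction using (sum)
open import Data.Nat.ListAction.Properties using (sum-++)
open import Data.List.Properties using (length-++; length-++-sucʳ; length-map; length-upTo; map-id; upTo-∷ʳ)
open import Data.List.Membership.Propositional using (_∈_; find)
open import Data.List.Membership.Propositional.Properties
open import Data.List.Relation.Unary.Any using (here; there)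
open import Data.List.Relation.Unary.All using (lookup)
open import Data.List.Relation.Unary.AllPairs using (_∷_)
open import Data.List.Relation.Unary.Unique.Propositional using (Unique)
open import Data.List.Relation.Binary.Subset.Propositional using (_⊆_)
import Data.List.Relation.Unary.Unique.DecPropositional.Properties as Unique
open import Relation.Nullary using (¬_; yes; no)
open import Relation.Binary.PropositionalEquality
open import Relation.Binary.Definitions using (tri<; tri≈; tri>)

module _ {A B : Set} (f : A → List B) where

  ∈-concatMap⁺′ : ∀ {xs x y} → x ∈ xs → y ∈ f x → y ∈ concatMap f xs
  ∈-concatMap⁺′ x∈xs y∈fx = ∈-concat⁺′ y∈fx (∈-map⁺ f x∈xs)

  ∈-concatMap⁻′ : ∀ xs {y} → y ∈ concatMap f xs → ∃[ x ] (x ∈ xs × y ∈ f x)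
  ∈-concatMap⁻′ xs y∈ = find (∈-concatMap⁻ f {xs = xs} y∈)

  length-concatMap : (g : A → ℕ) → (∀ x → length (f x) ≡ g x) →
                     ∀ xs → length (concatMap f xs) ≡ sum (map g xs)
  length-concatMap g len [] = refl
  length-concatMap g len (x ∷ xs) =
    trans (length-++ (f x)) (cong₂ _+_ (len x) (length-concatMap g len xs))

sum-map-const : ∀ {A : Set} c (xs : List A) → sum (map (λ _ → c) xs) ≡ length xs * c
sum-map-const c []       = refl
sum-map-const c (x ∷ xs) = cong (c +_) (sum-map-const c xs)

2*sum-upTo+n≡n*n : ∀ n → 2 * sum (upTo n) + n ≡ n * n
2*sum-upTo+n≡n*n zero    = refl
2*sum-upTo+n≡n*n (suc n) = begin
  2 * sum (upTo (suc n)) + suc n        ≡⟨ cong (λ xs → 2 * sum xs + suc n) (sym (upTo-∷ʳ n)) ⟩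
  2 * sum (upTo n ++ n ∷ []) + suc n    ≡⟨ cong (λ s → 2 * s + suc n) (sum-++ (upTo n) (n ∷ [])) ⟩
  2 * (sum (upTo n) + (n + 0)) + suc n  ≡⟨ regroup (sum (upTo n)) n ⟩
  (2 * sum (upTo n) + n) + (2 * n + 1)  ≡⟨ cong (_+ (2 * n + 1)) (2*sum-upTo+n≡n*n n) ⟩
  n * n + (2 * n + 1)                   ≡⟨ square-suc n ⟩
  suc n * suc n                         ∎
  where
  open ≡-Reasoning
  regroup : ∀ s n → 2 * (s + (n + 0)) + suc n ≡ (2 * s + n) + (2 * n + 1)
  regroup = solve-∀
  square-suc : ∀ n → n * n + (2 * n + 1) ≡ suc n * suc n
  square-suc = solve-∀

∈-++-remove : ∀ {A : Set} (xs : List A) {x ys z} → z ∈ xs ++ x ∷ ys → ¬ z ≡ x → z ∈ xs ++ ys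
∈-++-remove xs z∈ z≢x with ∈-++⁻ xs z∈
... | inj₁ z∈xs         = ∈-++⁺ˡ z∈xs
... | inj₂ (here z≡x)   = ⊥-elim (z≢x z≡x)
... | inj₂ (there z∈ys) = ∈-++⁺ʳ xs z∈ys

Unique-⊆⇒length≤ : ∀ {A : Set} {xs ys : List A} → Unique xs → xs ⊆ ys → length xs ≤ length ys
Unique-⊆⇒length≤ {xs = []}     _               _     = z≤n
Unique-⊆⇒length≤ {xs = x ∷ xs} (x∉xs ∷ unique) xs⊆ys with ∈-∃++ (xs⊆ys (here refl))
... | as , bs , refl = begin
  suc (length xs)         ≤⟨ s≤s (Unique-⊆⇒length≤ unique xs⊆as++bs) ⟩
  suc (length (as ++ bs)) ≡⟨ length-++-sucʳ as x bs ⟨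
  length (as ++ x ∷ bs)   ∎
  where
  open ≤-Reasoning
  xs⊆as++bs : xs ⊆ as ++ bs
  xs⊆as++bs z∈xs = ∈-++-remove as (xs⊆ys (there z∈xs)) (λ z≡x → lookup x∉xs z∈xs (sym z≡x))

[m+n]%o≢m : ∀ m n o .{{_ : NonZero o}} → 0 < n → n < o → ¬ (m + n) % o ≡ m
[m+n]%o≢m m n o 0<n n<o [m+n]%o≡m = <⇒≱ n<o (∣⇒≤ {{>-nonZero 0<n}} (divides ((m + n) / o) n≡q*o))
  where
  n≡q*o : n ≡ (m + n) / o * o
  n≡q*o = +-cancelˡ-≡ m _ _ (trans (m≡m%n+[m/n]*n (m + n) o) (cong (_+ (m + n) / o * o) [m+n]%o≡m))

4l+4≤2^l : ∀ {l} → 6 ≤ l → 4 * l + 4 ≤ 2 ^ l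
4l+4≤2^l 6≤l with m≤n⇒∃[o]m+o≡n 6≤l
... | k , refl = from-6 k
  where
  from-6 : ∀ k → 4 * (6 + k) + 4 ≤ 2 ^ (6 + k)
  from-6 zero    = m≤m+n 28 36
  from-6 (suc k) = begin
    4 * (7 + k) + 4                    ≡⟨ shift k ⟩
    (4 * (6 + k) + 4) + 4              ≤⟨ +-mono-≤ (from-6 k) (≤-trans (m≤n+m 4 (4 * (6 + k))) (from-6 k)) ⟩
    2 ^ (6 + k) + 2 ^ (6 + k)          ≡⟨ cong (2 ^ (6 + k) +_) (+-identityʳ _) ⟨
    2 ^ (7 + k)                        ∎
    where
    open ≤-Reasoning
    shift : ∀ k → 4 * (7 + k) + 4 ≡ (4 * (6 + k) + 4) + 4
    shift = solve-∀

edge-count-bound : ∀ l n S → 1 ≤ n → 4 * l + 4 ≤ n → 2 * S + n ≡ n * n →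
                   (n + n * (l + 1) + n * l) + S < n * n
edge-count-bound l n S 1≤n 4l+4≤n 2S+n≡n² = *-cancelˡ-< 2 _ _ (begin-strict
  2 * (A + S)               <⟨ m<m+n _ 1≤n ⟩
  2 * (A + S) + n           ≡⟨ distribute A S n ⟩
  2 * A + (2 * S + n)       ≤⟨ +-mono-≤ 2A≤n² (≤-reflexive 2S+n≡n²) ⟩
  n * n + n * n             ≡⟨ cong (n * n +_) (+-identityʳ (n * n)) ⟨
  2 * (n * n)               ∎)
  where
  open ≤-Reasoning
  A = n + n * (l + 1) + n * l
  distribute : ∀ A S n → 2 * (A + S) + n ≡ 2 * A + (2 * S + n)
  distribute = solve-∀
  factor : ∀ n l → 2 * (n + n * (l + 1) + n * l) ≡ n * (4 * l + 4)
  factor = solve-∀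
  2A≤n² : 2 * A ≤ n * n
  2A≤n² = subst (_≤ n * n) (sym (factor n l)) (*-monoʳ-≤ n 4l+4≤n)

top : ℕ → ℕ → Node
top l j = (l + 1 , j)

Adj-sym : ∀ {l u v} → Adj l u v → Adj l v u
Adj-sym (inj₁ uv∈) = inj₂ uv∈
Adj-sym (inj₂ vu∈) = inj₁ vu∈

_++ʷ_ : ∀ {l k k′ u v w} → Walk l k u v → Walk l k′ v w → Walk l (k + k′) u w
here       ++ʷ q = q
step uv p  ++ʷ q = step uv (p ++ʷ q)

DistLeq-trans : ∀ {l a b u v w} → DistLeq l u v a → DistLeq l v w b → DistLeq l u w (a + b)
DistLeq-trans (k , k≤a , p) (k′ , k′≤b , q) = k + k′ , +-mono-≤ k≤a k′≤b , p ++ʷ q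

≡⊎Adj⇒DistLeq1 : ∀ {l u v} → u ≡ v ⊎ Adj l u v → DistLeq l u v 1
≡⊎Adj⇒DistLeq1 (inj₁ refl) = 0 , z≤n , here
≡⊎Adj⇒DistLeq1 (inj₂ uv)   = 1 , ≤-refl , step uv here

≡⊎Adj-sym : ∀ {l u v} → u ≡ v ⊎ Adj l u v → v ≡ u ⊎ Adj l v u
≡⊎Adj-sym (inj₁ u≡v) = inj₁ (sym u≡v)
≡⊎Adj-sym {l} (inj₂ uv)  = inj₂ (Adj-sym {l} uv)

spoke∈edges3 : ∀ {l i j} → i ≤ l → j < 2 ^ l → (top l j , (i , j)) ∈ edges3 l
spoke∈edges3 {l} {i} {j} i≤l j<n =
  ∈-concatMap⁺′ _ (∈-upTo⁺ j<n) (∈-map⁺ (λ i → (top l j , (i , j))) (∈-upTo⁺ i<l+1))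
  where
  i<l+1 : i < l + 1
  i<l+1 = subst (i <_) (+-comm 1 l) (s≤s i≤l)

spoke : ∀ {l i j} → i ≤ l + 1 → j < 2 ^ l → top l j ≡ (i , j) ⊎ Adj l (top l j) (i , j)
spoke {l} {i} {j} i≤l+1 j<n with i ≟ l + 1
... | yes refl = inj₁ refl
... | no  i≢l+1 = inj₂ (inj₁ (∈-++⁺ʳ (edges1 l) (∈-++⁺ʳ (edges2 l) (∈-++⁺ˡ (spoke∈edges3 i≤l j<n)))))
  where
  i≤l : i ≤ l
  i≤l = ≤-pred (subst (i <_) (+-comm l 1) (≤∧≢⇒< i≤l+1 i≢l+1))

clique∈edges2 : ∀ {l j d} → j < 2 ^ l → d < 2 ^ l ∸ 1 →
                (top l j , top l (_%_ (j + suc d) (2 ^ l) {{m^n≢0 2 l}})) ∈ edges2 l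
clique∈edges2 {l} {j} j<n d<n-1 =
  ∈-concatMap⁺′ _ (∈-upTo⁺ j<n)
    (∈-map⁺ (λ p → (top l j , top l (_%_ (j + p) (2 ^ l) {{m^n≢0 2 l}}))) (∈-map⁺ suc (∈-upTo⁺ d<n-1)))

clique-adj : ∀ {l j j′} → j < j′ → j′ < 2 ^ l → Adj l (top l j) (top l j′)
clique-adj {l} {j} j<j′ j′<n with m≤n⇒∃[o]m+o≡n j<j′
... | d , refl = inj₁ (∈-++⁺ʳ (edges1 l) (∈-++⁺ˡ j,j′∈edges2))
  where
  instance _ = m^n≢0 2 l
  j+1+d%n≡1+j+d : (j + suc d) % 2 ^ l ≡ suc (j + d)
  j+1+d%n≡1+j+d = trans (cong (_% 2 ^ l) (+-suc j d)) (m<n⇒m%n≡m j′<n)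
  d<n-1 : d < 2 ^ l ∸ 1
  d<n-1 = ∸-monoˡ-≤ 1 (≤-trans (s≤s (s≤s (m≤n+m d j))) j′<n)
  j,j′∈edges2 : (top l j , top l (suc (j + d))) ∈ edges2 l
  j,j′∈edges2 = subst (λ k → (top l j , top l k) ∈ edges2 l) j+1+d%n≡1+j+d
                      (clique∈edges2 (<-trans (s≤s (m≤m+n j d)) j′<n) d<n-1)

clique : ∀ {l j j′} → j < 2 ^ l → j′ < 2 ^ l → top l j ≡ top l j′ ⊎ Adj l (top l j) (top l j′)
clique {l} {j} {j′} j<n j′<n with <-cmp j j′
... | tri< j<j′ _ _ = inj₂ (clique-adj j<j′ j′<n)
... | tri≈ _ refl _ = inj₁ refl
... | tri> _ _ j′<j = inj₂ (Adj-sym {l} (clique-adj j′<j j<n))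

diameter≤3 : ∀ l → DiamLeq l 3
diameter≤3 l (i , j) (i′ , j′) (i≤ , j<) (i′≤ , j′<) =
  DistLeq-trans (DistLeq-trans (≡⊎Adj⇒DistLeq1 (≡⊎Adj-sym {l} (spoke i≤ j<)))
                               (≡⊎Adj⇒DistLeq1 (clique j< j′<)))
                (≡⊎Adj⇒DistLeq1 (spoke i′≤ j′<))

ascendingTopPairs : ℕ → List (Node × Node)
ascendingTopPairs l = concatMap (λ k → map (λ j → (top l j , top l k)) (upTo k)) (upTo (2 ^ l))

normalize-level-< : ∀ a j k → j < k → normalize ((a , j) , (a , k)) ≡ ((a , j) , (a , k))
normalize-level-< a j k j<k with a <? a
... | yes a<a = ⊥-elim (<-irrefl refl a<a)
... | no _ with a ≟ a
...   | no a≢a = ⊥-elim (a≢a refl)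
...   | yes _ with k <? j
...     | yes k<j = ⊥-elim (<-asym j<k k<j)
...     | no _    = refl

normalize-level-> : ∀ a j k → k < j → normalize ((a , j) , (a , k)) ≡ ((a , k) , (a , j))
normalize-level-> a j k k<j with a <? a
... | yes a<a = ⊥-elim (<-irrefl refl a<a)
... | no _ with a ≟ a
...   | no a≢a = ⊥-elim (a≢a refl)
...   | yes _ with k <? j
...     | yes _   = refl
...     | no k≮j  = ⊥-elim (k≮j k<j)

ascending∈ascendingTopPairs : ∀ {l j k} → j < k → k < 2 ^ l → (top l j , top l k) ∈ ascendingTopPairs l
ascending∈ascendingTopPairs {l} {j} {k} j<k k<n =
  ∈-concatMap⁺′ _ (∈-upTo⁺ k<n) (∈-map⁺ (λ j → (top l j , top l k)) (∈-upTo⁺ j<k))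

normalize-clique∈ascendingTopPairs : ∀ {l j k} → j < 2 ^ l → k < 2 ^ l → ¬ k ≡ j →
                                     normalize (top l j , top l k) ∈ ascendingTopPairs l
normalize-clique∈ascendingTopPairs {l} {j} {k} j<n k<n k≢j with <-cmp j k
... | tri< j<k _ _ = subst (_∈ ascendingTopPairs l) (sym (normalize-level-< (l + 1) j k j<k))
                           (ascending∈ascendingTopPairs j<k k<n)
... | tri≈ _ j≡k _ = ⊥-elim (k≢j (sym j≡k))
... | tri> _ _ k<j = subst (_∈ ascendingTopPairs l) (sym (normalize-level-> (l + 1) j k k<j))
                           (ascending∈ascendingTopPairs k<j j<n)

normalize-edges2⊆ascendingTopPairs : ∀ {l e} → e ∈ edges2 l → normalize e ∈ ascendingTopPairs l
normalize-edges2⊆ascendingTopPairs {l} e∈ with ∈-concatMap⁻′ _ (upTo (2 ^ l)) e∈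
... | j , j∈ , e∈row with ∈-map⁻ _ e∈row
... | p , p∈ , refl with ∈-map⁻ suc p∈
... | d , d∈ , refl =
  normalize-clique∈ascendingTopPairs {l} (∈-upTo⁻ j∈) (m%n<n (j + suc d) (2 ^ l))
    ([m+n]%o≢m j (suc d) (2 ^ l) z<s 1+d<n)
  where
  instance _ = m^n≢0 2 l
  1+d<n : suc d < 2 ^ l
  1+d<n = subst (_≤ 2 ^ l) (+-comm (suc d) 1) (m≤o∸n⇒m+n≤o (suc d) (m^n>0 2 l) (∈-upTo⁻ d∈))

-- Rule 2 lists every clique edge in both orientations; its normal forms are ascending pairs.
edgeCover : ℕ → List (Node × Node)
edgeCover l = map normalize (edges1 l ++ edges3 l ++ edges4 l) ++ ascendingTopPairs l

EdgeSet⊆edgeCover : ∀ l → EdgeSet l ⊆ edgeCover l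
EdgeSet⊆edgeCover l e∈ with ∈-map⁻ normalize (∈-deduplicate⁻ _ (map normalize (edgeList l)) e∈)
... | e , e∈edges , refl with ∈-++⁻ (edges1 l) e∈edges
... | inj₁ e∈1 = ∈-++⁺ˡ (∈-map⁺ normalize (∈-++⁺ˡ e∈1))
... | inj₂ e∈234 with ∈-++⁻ (edges2 l) e∈234
... | inj₁ e∈2  = ∈-++⁺ʳ (map normalize (edges1 l ++ edges3 l ++ edges4 l)) (normalize-edges2⊆ascendingTopPairs {l} e∈2)
... | inj₂ e∈34 = ∈-++⁺ˡ (∈-map⁺ normalize (∈-++⁺ʳ (edges1 l) e∈34))

length-edgeCover : ∀ l → let n = 2 ^ l in
                   length (edgeCover l) ≡ (n + n * (l + 1) + n * l) + sum (upTo n)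
length-edgeCover l = begin
  length (edgeCover l)
    ≡⟨ length-++ (map normalize (edges1 l ++ edges3 l ++ edges4 l)) ⟩
  length (map normalize (edges1 l ++ edges3 l ++ edges4 l)) + length (ascendingTopPairs l)
    ≡⟨ cong (_+ length (ascendingTopPairs l)) (length-map normalize (edges1 l ++ edges3 l ++ edges4 l)) ⟩
  length (edges1 l ++ edges3 l ++ edges4 l) + length (ascendingTopPairs l)
    ≡⟨ cong (_+ length (ascendingTopPairs l)) (length-++ (edges1 l)) ⟩
  (length (edges1 l) + length (edges3 l ++ edges4 l)) + length (ascendingTopPairs l)
    ≡⟨ cong₂ (λ a b → (a + b) + length (ascendingTopPairs l)) len1 (trans (length-++ (edges3 l)) (cong₂ _+_ len3 len4)) ⟩
  (n + (n * (l + 1) + n * l)) + length (ascendingTopPairs l)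
    ≡⟨ cong₂ _+_ (sym (+-assoc n _ _)) lenT ⟩
  (n + n * (l + 1) + n * l) + sum (upTo n)
    ∎
  where
  open ≡-Reasoning
  n = 2 ^ l
  len1 : length (edges1 l) ≡ n
  len1 = trans (length-map _ (upTo n)) (length-upTo n)
  rows : ∀ {r : ℕ → ℕ → Node × Node} m → length (concatMap (λ j → map (r j) (upTo m)) (upTo n)) ≡ n * m
  rows {r} m = begin
    length (concatMap (λ j → map (r j) (upTo m)) (upTo n))
      ≡⟨ length-concatMap _ (λ _ → m) (λ j → trans (length-map (r j) (upTo m)) (length-upTo m)) (upTo n) ⟩
    sum (map (λ _ → m) (upTo n))  ≡⟨ sum-map-const m (upTo n) ⟩
    length (upTo n) * m           ≡⟨ cong (_* m) (length-upTo n) ⟩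
    n * m                         ∎
  len3 : length (edges3 l) ≡ n * (l + 1)
  len3 = rows (l + 1)
  len4 : length (edges4 l) ≡ n * l
  len4 = rows l
  lenT : length (ascendingTopPairs l) ≡ sum (upTo n)
  lenT = trans (length-concatMap _ (λ k → k) (λ k → trans (length-map _ (upTo k)) (length-upTo k)) (upTo n))
               (cong sum (map-id (upTo n)))

numEdges≤length-edgeCover : ∀ l → numEdges l ≤ length (edgeCover l)
numEdges≤length-edgeCover l =
  Unique-⊆⇒length≤ (Unique.deduplicate-! (≡-dec (≡-dec _≟_ _≟_) (≡-dec _≟_ _≟_)) (map normalize (edgeList l)))
                   (EdgeSet⊆edgeCover l)

claim3p1 : (l : ℕ) → 6 ≤ l → (numEdges l < 2 ^ (2 * l)) × DiamLeq l 3
claim3p1 l 6≤l = numEdges<4^l , diameter≤3 l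
  where
  n = 2 ^ l
  4^l≡n*n : 2 ^ (2 * l) ≡ n * n
  4^l≡n*n = trans (cong (λ k → 2 ^ (l + k)) (+-identityʳ l)) (^-distribˡ-+-* 2 l l)
  numEdges<4^l : numEdges l < 2 ^ (2 * l)
  numEdges<4^l = begin-strict
    numEdges l                                ≤⟨ numEdges≤length-edgeCover l ⟩
    length (edgeCover l)                      ≡⟨ length-edgeCover l ⟩
    (n + n * (l + 1) + n * l) + sum (upTo n)  <⟨ edge-count-bound l n _ (m^n>0 2 l) (4l+4≤2^l 6≤l) (2*sum-upTo+n≡n*n n) ⟩
    n * n                                     ≡⟨ 4^l≡n*n ⟨
    2 ^ (2 * l)                               ∎
    where open ≤-Reasoning
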